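{- Let $\mathcal{M}$ be a realized matroid over $\mathbb{Z}$ on the ground set $[n]$. Let $A\subseteq[n]$, $b\in[n]\setminus A$, and let $(A\cup\{b\},h)$ be an element of $\operatorname{Gr}\mathcal{M}$. Then there exists $l\in C_A$ such that $(A,l)\in\operatorname{Gr}\mathcal{M}$ and $(A\cup\{b\},h)$ covers $(A,l)$.
   Context: A matroid over $\mathbb{Z}$ on $[n]=\{1,\dots,n\}$ assigns to each $A\subseteq[n]$ a finitely generated abelian group $\mathcal{M}(A)$ (up to isomorphism). It is realized if a list $z_1,\dots,z_n\in\mathcal{M}(\emptyset)$ is fixed with $\mathcal{M}(A)=\mathcal{M}(\emptyset)/(z_i : i\in A)$ for all $A$. Write $\mathcal{M}(A)\cong\mathbb{Z}^{d(A)}\times G_A$ with $G_A$ finite (the torsion subgroup), and $C_A=\operatorname{Hom}(G_A,\mathbb{C}^*)$ its dual group. For $A\subseteq[n]$ and $b\notin A$, the canonical projection $\pi_{(A,b)}:\mathcal{M}(A)\to\mathcal{M}(A\cup\{b\})$ is the quotient map by the image of $z_b$; it sends $G_A$ into $G_{A\cup\{b\}}$, and the dual map $\pi^{(A,b)}:C_{A\cup\{b\}}\to C_A$ is $h\mapsto h\circ\pi_{(A,b)}|_{G_A}$. The set of torsions $\operatorname{Gr}\mathcal{M}$ is the set of pairs $(A,l)$ with $A\subseteq[n]$, $d(\emptyset)-d(A)=\#A$ and $l\in C_A$. For $(A\cup\{b\},h),(A,l)\in\operatorname{Gr}\mathcal{M}$ with $b\notin A$, we say $(A\cup\{b\},h)$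 covers $(A,l)$ if $\pi^{(A,b)}(h)=l$. -}

module Defs where

open import Level using (Level; _⊔_)
open import Data.Nat using (ℕ; zero; suc)
open import Data.Integer as ℤ using (ℤ; +_; -[1+_])
open import Data.Rational as ℚ using (ℚ)
open import Data.Fin using (Fin)
import Data.Fin as F
open import Data.Fin.Subset using (Subset; _∉_; _∪_; ⁅_⁆; ∣_∣; ⊥)
open import Data.Product using (Σ; ∃; _×_)
open import Relation.Binary.PropositionalEquality using (_≡_)
open import Relation.Nullary using (¬_)
open import Algebra.Bundles using (AbelianGroup)

-- ℚ/ℤ : rationals modulo integers (stands in for the roots of unity in ℂ*)
_≈QZ_ : ℚ → ℚ → Set
q ≈QZ r = Σ ℤ λ k → q ℚ.- r ≡ k ℚ./ 1

module _ {c ℓ : Level} (G : AbelianGroup c ℓ) where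
  open AbelianGroup G

  _·ℕ_ : ℕ → Carrier → Carrier
  zero ·ℕ x = ε
  suc m ·ℕ x = x ∙ (m ·ℕ x)

  _·ℤ_ : ℤ → Carrier → Carrier
  (+ m) ·ℤ x = m ·ℕ x
  -[1+ m ] ·ℤ x = (suc m ·ℕ x) ⁻¹

  ∑ : {k : ℕ} → (Fin k → Carrier) → Carrier
  ∑ {zero} f = ε
  ∑ {suc k} f = f F.zero ∙ ∑ (λ i → f (F.suc i))

  lin : {k : ℕ} → (Fin k → ℤ) → (Fin k → Carrier) → Carrier
  lin c v = ∑ (λ j → c j ·ℤ v j)

  FinitelyGenerated : Set (c ⊔ ℓ)
  FinitelyGenerated =
    Σ ℕ λ k → Σ (Fin k → Carrier) λ g → (x : Carrier) → Σ (Fin k → ℤ) λ a → x ≈ lin a g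

record RealizedMatroid (c ℓ : Level) (n : ℕ) : Set (Level.suc (c ⊔ ℓ)) where
  field
    M∅     : AbelianGroup c ℓ
    z     : Fin n → AbelianGroup.Carrier M∅
    fingen : FinitelyGenerated M∅

module Matroid {c ℓ : Level} {n : ℕ} (M : RealizedMatroid c ℓ n) where
  open RealizedMatroid M
  open AbelianGroup M∅

  InSpan : Subset n → Carrier → Set ℓ
  InSpan A x = Σ (Fin n → ℤ) λ a → ((i : Fin n) → i ∉ A → a i ≡ + 0) × (x ≈ lin M∅ a z)

  -- equality in M(A) = M(∅)/(z_i : i ∈ A)
  _~[_]_ : Carrier → Subset n → Carrier → Set ℓ
  x ~[ A ] y = InSpan A (x - y)

  -- x represents an element of the torsion subgroup G_A of M(A)
  Tors : Subset n → Carrier → Set ℓ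
  Tors A x = Σ ℕ λ m → InSpan A (_·ℕ_ M∅ (suc m) x)

  Indep : Subset n → {k : ℕ} → (Fin k → Carrier) → Set ℓ
  Indep A {k} v = (a : Fin k → ℤ) → InSpan A (lin M∅ a v) → (j : Fin k) → a j ≡ + 0

  IsRank : Subset n → ℕ → Set (c ⊔ ℓ)
  IsRank A k = Σ (Fin k → Carrier) (λ v → Indep A v)
             × ((v : Fin (suc k) → Carrier) → ¬ Indep A v)

  GrCond : Subset n → Set (c ⊔ ℓ)
  GrCond A = Σ ℕ λ d₀ → Σ ℕ λ dA → IsRank ⊥ d₀ × IsRank A dA × (d₀ ≡ dA Data.Nat.+ ∣ A ∣)

  -- C_A = Hom(G_A, ℚ/ℤ)
  record Char (A : Subset n) : Set (c ⊔ ℓ) where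
    field
      χ    : (x : Carrier) → Tors A x → ℚ
      resp : (x y : Carrier) (tx : Tors A x) (ty : Tors A y) → x ~[ A ] y → χ x tx ≈QZ χ y ty
      hom  : (x y : Carrier) (tx : Tors A x) (ty : Tors A y) (txy : Tors A (x ∙ y))
             → χ (x ∙ y) txy ≈QZ (χ x tx ℚ.+ χ y ty)
  open Char public

  -- (A ∪ {b}, h) covers (A, l) : π^{(A,b)}(h) = l, i.e. h ∘ π_{(A,b)} = l on G_A
  Covers : (A : Subset n) (b : Fin n) → Char (A ∪ ⁅ b ⁆) → Char A → Set (c ⊔ ℓ)
  Covers A b h l = (x : Carrier) (tA : Tors A x) (tAb : Tors (A ∪ ⁅ b ⁆) x)
                   → χ l x tA ≈QZ χ h x tAb

-- The character l is h ∘ π_{(A,b)}; as every M(B) is a quotient of M(∅), this is the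
-- restriction of h to the elements of M(∅) that are torsion modulo A, and it covers
-- (A ∪ {b}, h) by construction.  The content is the rank identity
-- d(A) = d(A ∪ {b}) + 1.  Adding one generator z_b to the relations lowers the free
-- rank by at most one: if u is independent modulo B, every relation among u modulo
-- B ∪ {b} is a multiple of z_b modulo B, so any two such relations are proportional
-- and removing one vector of u leaves a family independent modulo B ∪ {b}.  Hence
-- d(A) ≤ d(A ∪ {b}) + 1 and, adding the elements of A one at a time,
-- d(A) ≥ d(∅) − #A = d(A ∪ {b}) + 1.  The latter shows that z_b is not torsion in
-- M(A), since otherwise independence modulo A would persist modulo A ∪ {b}; so z_b
-- together with an independent family of M(A ∪ {b}) is independent in M(A).
-- Constructively the rank bounds hold only under double negation, which suffices
-- because they are only used to refute.
{-# OPTIONS --safe #-}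
module Submission where

open import Defs
open import Level using (Level; _⊔_)
open import Algebra.Bundles using (AbelianGroup)
open import Data.Bool using (true; false)
open import Data.Nat as ℕ using (ℕ; zero; suc)
import Data.Nat.Properties as ℕ
open import Data.Integer as ℤ using (ℤ; +_; -[1+_]; +[1+_]; 0ℤ; -1ℤ; _⊖_)
import Data.Integer.Properties as ℤ
open import Data.Fin using (Fin; zero; suc; punchIn; _≟_)
open import Data.Fin.Properties using (punchInᵢ≢i)
open import Data.Fin.Subset using (Subset; _∈_; _∉_; _⊆_; _⊂_; _∪_; ⁅_⁆; ∣_∣; ⊥)
  renaming (_-_ to _∖_)
open import Data.Fin.Subset.Properties
  using ( x∈⁅x⁆; x∈⁅y⁆⇒x≡y; x∈p∪q⁻; p⊆p∪q; q⊆p∪q; ∪-identityʳ; p─⊥≡p; x∈p∧x≢y⇒x∈p-y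
        ; x∈p⇒p-x⊂p; nonempty?; Empty-unique; ∣⊥∣≡0 )
open import Data.Fin.Subset.Induction using (⊂-wellFounded; Acc; acc)
open import Data.Vec using (_∷_; here; there)
import Data.Vec.Functional as Vector
open import Data.Vec.Functional using (removeAt; insertAt; updateAt)
open import Data.Vec.Functional.Properties
  using (insertAt-lookup; insertAt-punchIn; updateAt-updates; updateAt-minimal)
open import Data.Product using (Σ; ∃; _×_; _,_; proj₁; uncurry)
open import Data.Sum using ([_,_]′)
open import Effect.Monad using (RawMonad)
open import Function using (_∘_; id)
open import Relation.Nullary using (¬_; Dec; yes; no; contradiction)
open import Relation.Nullary.Decidable using (decidable-stable; ¬¬-excluded-middle)
open import Relation.Nullary.Negation using (¬¬-map; ¬¬-Monad)
open import Relation.Binary.PropositionalEquality as ≡ using (_≡_; _≢_; _≗_)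

module IntegerMultiples {c ℓ : Level} (G : AbelianGroup c ℓ) where
  open AbelianGroup G
  open import Algebra.Properties.AbelianGroup G using (⁻¹-∙-comm; ε⁻¹≈ε; inverseˡ-unique)
  open import Algebra.Properties.CommutativeSemigroup commutativeSemigroup using (interchange)
  open import Algebra.Properties.CommutativeMonoid.Mult commutativeMonoid
    using (×-congʳ; ×-homo-+; ×-distrib-+) renaming (_×_ to _×ₙ_)
  open import Algebra.Properties.CommutativeMonoid.Sum commutativeMonoid
    using (sum; sum-cong-≋; sum-remove; ∑-distrib-+; sum-replicate-zero)
  open import Relation.Binary.Reasoning.Setoid setoid

  infixr 8 _·ₙ_ _·_

  _·ₙ_ : ℕ → Carrier → Carrier
  _·ₙ_ = _·ℕ_ G

  _·_ : ℤ → Carrier → Carrier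
  _·_ = _·ℤ_ G

  ·ₙ≡× : ∀ m x → m ·ₙ x ≡ m ×ₙ x
  ·ₙ≡× zero    x = ≡.refl
  ·ₙ≡× (suc m) x = ≡.cong (x ∙_) (·ₙ≡× m x)

  ·ₙ-congʳ : ∀ m {x y} → x ≈ y → m ·ₙ x ≈ m ·ₙ y
  ·ₙ-congʳ m {x} {y} rewrite ·ₙ≡× m x | ·ₙ≡× m y = ×-congʳ m

  ·ₙ-homo-+ : ∀ m n x → (m ℕ.+ n) ·ₙ x ≈ m ·ₙ x ∙ n ·ₙ x
  ·ₙ-homo-+ m n x rewrite ·ₙ≡× (m ℕ.+ n) x | ·ₙ≡× m x | ·ₙ≡× n x = ×-homo-+ x m n

  ·ₙ-distrib-∙ : ∀ m x y → m ·ₙ (x ∙ y) ≈ m ·ₙ x ∙ m ·ₙ y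
  ·ₙ-distrib-∙ m x y rewrite ·ₙ≡× m (x ∙ y) | ·ₙ≡× m x | ·ₙ≡× m y = ×-distrib-+ x y m

  ·ₙ-ε : ∀ m → m ·ₙ ε ≈ ε
  ·ₙ-ε zero    = refl
  ·ₙ-ε (suc m) = trans (identityˡ _) (·ₙ-ε m)

  ·-congʳ : ∀ i {x y} → x ≈ y → i · x ≈ i · y
  ·-congʳ (+ m)    = ·ₙ-congʳ m
  ·-congʳ -[1+ m ] = ⁻¹-cong ∘ ·ₙ-congʳ (suc m)

  ·-ε : ∀ i → i · ε ≈ ε
  ·-ε (+ m)    = ·ₙ-ε m
  ·-ε -[1+ m ] = trans (⁻¹-cong (·ₙ-ε (suc m))) ε⁻¹≈ε

  ·-distrib-∙ : ∀ i x y → i · (x ∙ y) ≈ i · x ∙ i · y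
  ·-distrib-∙ (+ m)        = ·ₙ-distrib-∙ m
  ·-distrib-∙ -[1+ m ] x y = trans (⁻¹-cong (·ₙ-distrib-∙ (suc m) x y)) (sym (⁻¹-∙-comm _ _))

  ·-⁻¹ : ∀ i x → i · (x ⁻¹) ≈ (i · x) ⁻¹
  ·-⁻¹ i x = inverseˡ-unique _ _ (begin
    i · (x ⁻¹) ∙ i · x  ≈⟨ ·-distrib-∙ i (x ⁻¹) x ⟨
    i · (x ⁻¹ ∙ x)      ≈⟨ ·-congʳ i (inverseˡ x) ⟩
    i · ε               ≈⟨ ·-ε i ⟩
    ε                   ∎)

  -1·x≈x⁻¹ : ∀ x → -1ℤ · x ≈ x ⁻¹
  -1·x≈x⁻¹ x = ⁻¹-cong (identityʳ x)

  xy∙xz⁻¹≈y∙z⁻¹ : ∀ x y z → (x ∙ y) ∙ (x ∙ z) ⁻¹ ≈ y ∙ z ⁻¹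
  xy∙xz⁻¹≈y∙z⁻¹ x y z = begin
    (x ∙ y) ∙ (x ∙ z) ⁻¹     ≈⟨ ∙-congˡ (⁻¹-∙-comm x z) ⟨
    (x ∙ y) ∙ (x ⁻¹ ∙ z ⁻¹)  ≈⟨ interchange x y (x ⁻¹) (z ⁻¹) ⟩
    (x ∙ x ⁻¹) ∙ (y ∙ z ⁻¹)  ≈⟨ ∙-congʳ (inverseʳ x) ⟩
    ε ∙ (y ∙ z ⁻¹)           ≈⟨ identityˡ _ ⟩
    y ∙ z ⁻¹                 ∎

  ·-⊖ : ∀ m n x → (m ⊖ n) · x ≈ m ·ₙ x ∙ (n ·ₙ x) ⁻¹
  ·-⊖ m       zero    x = sym (trans (∙-congˡ ε⁻¹≈ε) (identityʳ _))
  ·-⊖ zero    (suc n) x = sym (identityˡ _)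
  ·-⊖ (suc m) (suc n) x = begin
    (suc m ⊖ suc n) · x            ≡⟨ ≡.cong (_· x) (ℤ.[1+m]⊖[1+n]≡m⊖n m n) ⟩
    (m ⊖ n) · x                    ≈⟨ ·-⊖ m n x ⟩
    m ·ₙ x ∙ (n ·ₙ x) ⁻¹           ≈⟨ xy∙xz⁻¹≈y∙z⁻¹ x _ _ ⟨
    (x ∙ m ·ₙ x) ∙ (x ∙ n ·ₙ x) ⁻¹ ∎

  ·-homo-+ : ∀ i j x → (i ℤ.+ j) · x ≈ i · x ∙ j · x
  ·-homo-+ (+ m)    (+ n)    x = ·ₙ-homo-+ m n x
  ·-homo-+ (+ m)    -[1+ n ] x = ·-⊖ m (suc n) x
  ·-homo-+ -[1+ m ] (+ n)    x = trans (·-⊖ n (suc m) x) (comm _ _)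
  ·-homo-+ -[1+ m ] -[1+ n ] x = begin
    (suc (suc (m ℕ.+ n)) ·ₙ x) ⁻¹    ≡⟨ ≡.cong (λ k → (suc k ·ₙ x) ⁻¹) (ℕ.+-suc m n) ⟨
    ((suc m ℕ.+ suc n) ·ₙ x) ⁻¹      ≈⟨ ⁻¹-cong (·ₙ-homo-+ (suc m) (suc n) x) ⟩
    (suc m ·ₙ x ∙ suc n ·ₙ x) ⁻¹     ≈⟨ ⁻¹-∙-comm _ _ ⟨
    (suc m ·ₙ x) ⁻¹ ∙ (suc n ·ₙ x) ⁻¹ ∎

  ·-neg : ∀ i x → (ℤ.- i) · x ≈ (i · x) ⁻¹
  ·-neg i x = inverseˡ-unique _ _ (begin
    (ℤ.- i) · x ∙ i · x  ≈⟨ ·-homo-+ (ℤ.- i) i x ⟨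
    (ℤ.- i ℤ.+ i) · x    ≡⟨ ≡.cong (_· x) (ℤ.+-inverseˡ i) ⟩
    ε                    ∎)

  +·-homo-* : ∀ m j x → (+ m ℤ.* j) · x ≈ m ·ₙ j · x
  +·-homo-* zero    j x = refl
  +·-homo-* (suc m) j x = begin
    (+[1+ m ] ℤ.* j) · x       ≡⟨ ≡.cong (_· x) (ℤ.suc-* (+ m) j) ⟩
    (j ℤ.+ + m ℤ.* j) · x      ≈⟨ ·-homo-+ j (+ m ℤ.* j) x ⟩
    j · x ∙ (+ m ℤ.* j) · x    ≈⟨ ∙-congˡ (+·-homo-* m j x) ⟩
    j · x ∙ m ·ₙ j · x         ∎

  ·-homo-* : ∀ i j x → (i ℤ.* j) · x ≈ i · j · x
  ·-homo-* (+ m)    j x = +·-homo-* m j x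
  ·-homo-* -[1+ m ] j x = begin
    (-[1+ m ] ℤ.* j) · x       ≡⟨ ≡.cong (_· x) (ℤ.neg-distribˡ-* +[1+ m ] j) ⟨
    (ℤ.- (+[1+ m ] ℤ.* j)) · x ≈⟨ ·-neg (+[1+ m ] ℤ.* j) x ⟩
    ((+[1+ m ] ℤ.* j) · x) ⁻¹  ≈⟨ ⁻¹-cong (+·-homo-* (suc m) j x) ⟩
    (suc m ·ₙ j · x) ⁻¹        ∎

  ·-comm : ∀ i j x → i · j · x ≈ j · i · x
  ·-comm i j x = begin
    i · j · x       ≈⟨ ·-homo-* i j x ⟨
    (i ℤ.* j) · x   ≡⟨ ≡.cong (_· x) (ℤ.*-comm i j) ⟩
    (j ℤ.* i) · x   ≈⟨ ·-homo-* j i x ⟩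
    j · i · x       ∎

  ∑≡sum : ∀ {k} (f : Fin k → Carrier) → ∑ G f ≡ sum f
  ∑≡sum {zero}  f = ≡.refl
  ∑≡sum {suc k} f = ≡.cong (f zero ∙_) (∑≡sum (f ∘ suc))

  ∑-cong : ∀ {k} {f g : Fin k → Carrier} → (∀ j → f j ≈ g j) → ∑ G f ≈ ∑ G g
  ∑-cong {f = f} {g} f≈g rewrite ∑≡sum f | ∑≡sum g = sum-cong-≋ f≈g

  ∑-distrib-∙ : ∀ {k} (f g : Fin k → Carrier) → ∑ G (λ j → f j ∙ g j) ≈ ∑ G f ∙ ∑ G g
  ∑-distrib-∙ f g rewrite ∑≡sum (λ j → f j ∙ g j) | ∑≡sum f | ∑≡sum g = ∑-distrib-+ f g

  ∑-remove : ∀ {k} j (f : Fin (suc k) → Carrier) → ∑ G f ≈ f j ∙ ∑ G (removeAt f j)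
  ∑-remove j f rewrite ∑≡sum f | ∑≡sum (removeAt f j) = sum-remove f

  ∑-ε : ∀ k → ∑ G {k} (λ _ → ε) ≈ ε
  ∑-ε k rewrite ∑≡sum {k} (λ _ → ε) = sum-replicate-zero k

  ∑-·-comm : ∀ {k} i (f : Fin k → Carrier) → ∑ G (λ j → i · f j) ≈ i · ∑ G f
  ∑-·-comm {zero}  i f = sym (·-ε i)
  ∑-·-comm {suc k} i f = trans (∙-congˡ (∑-·-comm i (f ∘ suc))) (sym (·-distrib-∙ i _ _))

  module _ {k : ℕ} (v : Fin k → Carrier) where

    lin-cong : ∀ {a b : Fin k → ℤ} → a ≗ b → lin G a v ≈ lin G b v
    lin-cong {a} a≗b = ∑-cong {f = λ j → a j · v j} (λ j → reflexive (≡.cong (_· v j) (a≗b j)))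

    lin-zero : ∀ {a : Fin k → ℤ} → (∀ j → a j ≡ 0ℤ) → lin G a v ≈ ε
    lin-zero a≡0 = trans (lin-cong a≡0) (∑-ε k)

    lin-+ : ∀ (a b : Fin k → ℤ) → lin G (λ j → a j ℤ.+ b j) v ≈ lin G a v ∙ lin G b v
    lin-+ a b = trans (∑-cong (λ j → ·-homo-+ (a j) (b j) (v j)))
                      (∑-distrib-∙ (λ j → a j · v j) (λ j → b j · v j))

    lin-* : ∀ i (a : Fin k → ℤ) → lin G (λ j → i ℤ.* a j) v ≈ i · lin G a v
    lin-* i a = trans (∑-cong (λ j → ·-homo-* i (a j) (v j))) (∑-·-comm i (λ j → a j · v j))

    lin-neg : ∀ (a : Fin k → ℤ) → lin G (λ j → ℤ.- a j) v ≈ (lin G a v) ⁻¹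
    lin-neg a = begin
      lin G (λ j → ℤ.- a j) v      ≈⟨ lin-cong (λ j → ℤ.-1*i≡-i (a j)) ⟨
      lin G (λ j → -1ℤ ℤ.* a j) v  ≈⟨ lin-* -1ℤ a ⟩
      -1ℤ · lin G a v              ≈⟨ -1·x≈x⁻¹ _ ⟩
      (lin G a v) ⁻¹               ∎

    lin-− : ∀ (a b : Fin k → ℤ) → lin G (λ j → a j ℤ.- b j) v ≈ lin G a v - lin G b v
    lin-− a b = trans (lin-+ a (ℤ.-_ ∘ b)) (∙-congˡ (lin-neg b))

  lin-removeAt : ∀ {k} (a : Fin (suc k) → ℤ) v j →
                 lin G a v ≈ a j · v j ∙ lin G (removeAt a j) (removeAt v j)
  lin-removeAt a v j = ∑-remove j (λ i → a i · v i)

  lin-insertAt : ∀ {k} (a : Fin k → ℤ) v j → lin G (insertAt a j 0ℤ) v ≈ lin G a (removeAt v j)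
  lin-insertAt {k} a v j = begin
    lin G a″ v                                          ≈⟨ lin-removeAt a″ v j ⟩
    a″ j · v j ∙ lin G (removeAt a″ j) (removeAt v j)   ≈⟨ ∙-cong a″j·vj≈ε (lin-cong _ (insertAt-punchIn a j 0ℤ)) ⟩
    ε ∙ lin G a (removeAt v j)                          ≈⟨ identityˡ _ ⟩
    lin G a (removeAt v j)                              ∎
    where
    a″ : Fin (suc k) → ℤ
    a″ = insertAt a j 0ℤ
    a″j·vj≈ε : a″ j · v j ≈ ε
    a″j·vj≈ε = reflexive (≡.cong (_· v j) (insertAt-lookup a j 0ℤ))

  lin-sparse : ∀ {k} (a : Fin k → ℤ) v j → (∀ i → i ≢ j → a i ≡ 0ℤ) → lin G a v ≈ a j · v j
  lin-sparse {suc k} a v j a≡0 = begin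
    lin G a v                                         ≈⟨ lin-removeAt a v j ⟩
    a j · v j ∙ lin G (removeAt a j) (removeAt v j)   ≈⟨ ∙-congˡ (lin-zero _ (λ i → a≡0 _ (punchInᵢ≢i j i))) ⟩
    a j · v j ∙ ε                                     ≈⟨ identityʳ _ ⟩
    a j · v j                                         ∎

  δ : ∀ {k} → Fin k → ℤ → Fin k → ℤ
  δ j e = updateAt (λ _ → 0ℤ) j (λ _ → e)

  lin-δ : ∀ {k} (v : Fin k → Carrier) j e → lin G (δ j e) v ≈ e · v j
  lin-δ v j e = trans (lin-sparse (δ j e) v j (λ i i≢j → updateAt-minimal i j _ i≢j))
                      (reflexive (≡.cong (_· v j) (updateAt-updates j _)))

x∉p⇒∣p∪⁅x⁆∣≡1+∣p∣ : ∀ {n} {p : Subset n} {x} → x ∉ p → ∣ p ∪ ⁅ x ⁆ ∣ ≡ suc ∣ p ∣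
x∉p⇒∣p∪⁅x⁆∣≡1+∣p∣ {p = true  ∷ p} {zero}  x∉p = contradiction here x∉p
x∉p⇒∣p∪⁅x⁆∣≡1+∣p∣ {p = false ∷ p} {zero}  x∉p = ≡.cong (suc ∘ ∣_∣) (∪-identityʳ p)
x∉p⇒∣p∪⁅x⁆∣≡1+∣p∣ {p = true  ∷ p} {suc x} x∉p = ≡.cong suc (x∉p⇒∣p∪⁅x⁆∣≡1+∣p∣ (x∉p ∘ there))
x∉p⇒∣p∪⁅x⁆∣≡1+∣p∣ {p = false ∷ p} {suc x} x∉p = x∉p⇒∣p∪⁅x⁆∣≡1+∣p∣ (x∉p ∘ there)

x∈p⇒∣p∣≡1+∣p∖x∣ : ∀ {n} {p : Subset n} {x} → x ∈ p → ∣ p ∣ ≡ suc ∣ p ∖ x ∣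
x∈p⇒∣p∣≡1+∣p∖x∣ {p = true  ∷ p} here        = ≡.cong (suc ∘ ∣_∣) (≡.sym (p─⊥≡p p))
x∈p⇒∣p∣≡1+∣p∖x∣ {p = true  ∷ p} (there x∈p) = ≡.cong suc (x∈p⇒∣p∣≡1+∣p∖x∣ x∈p)
x∈p⇒∣p∣≡1+∣p∖x∣ {p = false ∷ p} (there x∈p) = x∈p⇒∣p∣≡1+∣p∖x∣ x∈p

p⊆p∖x∪⁅x⁆ : ∀ {n} {p : Subset n} x → p ⊆ (p ∖ x) ∪ ⁅ x ⁆
p⊆p∖x∪⁅x⁆ {p = p} x {y} y∈p with y ≟ x
... | yes ≡.refl = q⊆p∪q (p ∖ x) ⁅ x ⁆ (x∈⁅x⁆ x)
... | no  y≢x    = p⊆p∪q ⁅ x ⁆ (x∈p∧x≢y⇒x∈p-y y∈p y≢x)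

module Quotients {c ℓ : Level} {n : ℕ} (M : RealizedMatroid c ℓ n) where
  open RealizedMatroid M
  open AbelianGroup M∅
  open import Algebra.Properties.AbelianGroup M∅
    using ( ⁻¹-anti-homo‿-; ⁻¹-involutive; ε⁻¹≈ε; x≈y⇒x∙y⁻¹≈ε
          ; //-rightDividesˡ; \\-leftDividesʳ; //-cong₂ )
  open Matroid M
  open IntegerMultiples M∅

  private variable
    B B′ : Subset n
    b : Fin n
    x y w : Carrier
    k : ℕ
    e : ℤ

  InSpan-resp : x ≈ y → InSpan B x → InSpan B y
  InSpan-resp x≈y (a , a-supp , x≈) = a , a-supp , trans (sym x≈y) x≈

  InSpan-ε : InSpan B ε
  InSpan-ε = (λ _ → 0ℤ) , (λ _ _ → ≡.refl) , sym (lin-zero z (λ _ → ≡.refl))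

  InSpan-∙ : InSpan B x → InSpan B y → InSpan B (x ∙ y)
  InSpan-∙ (a , a-supp , x≈) (a′ , a′-supp , y≈) =
    (λ i → a i ℤ.+ a′ i) ,
    (λ i i∉B → ≡.cong₂ ℤ._+_ (a-supp i i∉B) (a′-supp i i∉B)) ,
    trans (∙-cong x≈ y≈) (sym (lin-+ z a a′))

  InSpan-· : ∀ e → InSpan B x → InSpan B (e · x)
  InSpan-· e (a , a-supp , x≈) =
    (λ i → e ℤ.* a i) ,
    (λ i i∉B → ≡.trans (≡.cong (e ℤ.*_) (a-supp i i∉B)) (ℤ.*-zeroʳ e)) ,
    trans (·-congʳ e x≈) (sym (lin-* z e a))

  InSpan-⁻¹ : InSpan B x → InSpan B (x ⁻¹)
  InSpan-⁻¹ = InSpan-resp (-1·x≈x⁻¹ _) ∘ InSpan-· -1ℤ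

  InSpan-mono : B ⊆ B′ → InSpan B x → InSpan B′ x
  InSpan-mono B⊆B′ (a , a-supp , x≈) = a , (λ i i∉B′ → a-supp i (i∉B′ ∘ B⊆B′)) , x≈

  InSpan-z : b ∈ B → ∀ e → InSpan B (e · z b)
  InSpan-z {b = b} {B = B} b∈B e = δ b e , δ-supp , sym (lin-δ z b e)
    where
    δ-supp : ∀ i → i ∉ B → δ b e i ≡ 0ℤ
    δ-supp i i∉B = updateAt-minimal i b _ (λ { ≡.refl → i∉B b∈B })

  ≈⇒~ : x ≈ y → x ~[ B ] y
  ≈⇒~ x≈y = InSpan-resp (sym (x≈y⇒x∙y⁻¹≈ε x≈y)) InSpan-ε

  ~-sym : x ~[ B ] y → y ~[ B ] x
  ~-sym = InSpan-resp (⁻¹-anti-homo‿- _ _) ∘ InSpan-⁻¹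

  ~-trans : x ~[ B ] y → y ~[ B ] w → x ~[ B ] w
  ~-trans {x = x} {y = y} {w = w} x~y y~w = InSpan-resp x-y∙y-w≈x-w (InSpan-∙ x~y y~w)
    where
    x-y∙y-w≈x-w : (x - y) ∙ (y - w) ≈ x - w
    x-y∙y-w≈x-w = trans (sym (assoc _ _ _)) (∙-congʳ (//-rightDividesˡ y x))

  ~-· : ∀ e → x ~[ B ] y → (e · x) ~[ B ] (e · y)
  ~-· e = InSpan-resp (trans (·-distrib-∙ e _ _) (∙-congˡ (·-⁻¹ e _))) ∘ InSpan-· e

  InSpan⇒~ε : InSpan B x → x ~[ B ] ε
  InSpan⇒~ε = InSpan-resp (sym (trans (∙-congˡ ε⁻¹≈ε) (identityʳ _)))

  ~ε⇒InSpan : x ~[ B ] ε → InSpan B x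
  ~ε⇒InSpan = InSpan-resp (trans (∙-congˡ ε⁻¹≈ε) (identityʳ _))

  InSpan-∪⁅⁆⁺ : InSpan B (e · z b ∙ x) → InSpan (B ∪ ⁅ b ⁆) x
  InSpan-∪⁅⁆⁺ {B = B} {e = e} {b = b} s = InSpan-resp (\\-leftDividesʳ _ _)
    (InSpan-∙ (InSpan-⁻¹ (InSpan-z (q⊆p∪q B ⁅ b ⁆ (x∈⁅x⁆ b)) e)) (InSpan-mono (p⊆p∪q ⁅ b ⁆) s))

  InSpan-∪⁅⁆⁻ : InSpan (B ∪ ⁅ b ⁆) x → ∃ λ e → x ~[ B ] (e · z b)
  InSpan-∪⁅⁆⁻ {B = B} {b = b} {x = x} (a , a-supp , x≈) = a b , a′ , a′-supp , x-e·z≈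
    where
    a′ : Fin n → ℤ
    a′ i = a i ℤ.- δ b (a b) i
    a′-supp : ∀ i → i ∉ B → a′ i ≡ 0ℤ
    a′-supp i i∉B with i ≟ b
    ... | yes ≡.refl = ≡.trans (≡.cong (λ t → a i ℤ.- t) (updateAt-updates i _)) (ℤ.+-inverseʳ (a i))
    ... | no  i≢b    = ≡.cong₂ ℤ._-_
      (a-supp i ([ i∉B , i≢b ∘ x∈⁅y⁆⇒x≡y b ]′ ∘ x∈p∪q⁻ B ⁅ b ⁆)) (updateAt-minimal i b _ i≢b)
    x-e·z≈ : x - a b · z b ≈ lin M∅ a′ z
    x-e·z≈ = sym (trans (lin-− z a (δ b (a b))) (//-cong₂ (sym x≈) (lin-δ z b (a b))))

  InSpan-multiple⇒Tors : e ≢ 0ℤ → InSpan B (e · x) → Tors B x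
  InSpan-multiple⇒Tors {e = + zero}   e≢0 _ = contradiction ≡.refl e≢0
  InSpan-multiple⇒Tors {e = +[1+ m ]} _   s = m , s
  InSpan-multiple⇒Tors {e = -[1+ m ]} _   s = m , InSpan-resp (⁻¹-involutive _) (InSpan-⁻¹ s)

  Tors-mono : B ⊆ B′ → Tors B x → Tors B′ x
  Tors-mono B⊆B′ (m , s) = m , InSpan-mono B⊆B′ s

  restrict : B ⊆ B′ → Char B′ → Char B
  restrict B⊆B′ h = record
    { χ    = λ x tx → χ h x (Tors-mono B⊆B′ tx)
    ; resp = λ x y tx ty x~y → resp h x y _ _ (InSpan-mono B⊆B′ x~y)
    ; hom  = λ x y tx ty txy → hom h x y _ _ _
    }

  restrict-covers : ∀ A b (h : Char (A ∪ ⁅ b ⁆)) → Covers A b h (restrict (p⊆p∪q ⁅ b ⁆) h)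
  restrict-covers A b h x tA tAb = resp h x x _ tAb (≈⇒~ refl)

  IndepFamily : Subset n → ℕ → Set (c ⊔ ℓ)
  IndepFamily B k = Σ (Fin k → Carrier) (Indep B)

  IndepFamily-antimono : B ⊆ B′ → IndepFamily B′ k → IndepFamily B k
  IndepFamily-antimono B⊆B′ (u , indep) = u , λ a → indep a ∘ InSpan-mono B⊆B′

  Indep-∪⁅⁆-Tors : (u : Fin k → Carrier) → Tors B (z b) → Indep B u → Indep (B ∪ ⁅ b ⁆) u
  Indep-∪⁅⁆-Tors {B = B} {b = b} u (m , m·z∈B) indep a a-rel i
    with InSpan-∪⁅⁆⁻ a-rel
  ... | e , lin~e·z =
    [ (λ ()) , id ]′ (ℤ.i*j≡0⇒i≡0∨j≡0 +[1+ m ] (indep (λ j → +[1+ m ] ℤ.* a j) m·lin∈B i))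
    where
    m·lin~ε : (+[1+ m ] · lin M∅ a u) ~[ B ] ε
    m·lin~ε = ~-trans (~-· +[1+ m ] lin~e·z)
              (~-trans (≈⇒~ (·-comm +[1+ m ] e (z b)))
              (~-trans (~-· e (InSpan⇒~ε m·z∈B)) (≈⇒~ (·-ε e))))
    m·lin∈B : InSpan B (lin M∅ (λ j → +[1+ m ] ℤ.* a j) u)
    m·lin∈B = InSpan-resp (sym (lin-* u +[1+ m ] a)) (~ε⇒InSpan m·lin~ε)

  Indep-∷ : (v : Fin k → Carrier) → ¬ Tors B (z b) → Indep (B ∪ ⁅ b ⁆) v
          → Indep B (z b Vector.∷ v)
  Indep-∷ {B = B} {b = b} v ¬tors indep a a-rel = λ where
      zero    → head≡0
      (suc i) → tail≡0 i
    where
    -- definitionally, a-rel : InSpan B (a zero · z b ∙ lin M∅ (a ∘ suc) v)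
    tail≡0 : ∀ i → a (suc i) ≡ 0ℤ
    tail≡0 = indep (a ∘ suc) (InSpan-∪⁅⁆⁺ {e = a zero} a-rel)
    head≡0 : a zero ≡ 0ℤ
    head≡0 = decidable-stable (a zero ℤ.≟ 0ℤ) λ a₀≢0 → ¬tors (InSpan-multiple⇒Tors a₀≢0
      (InSpan-resp (trans (∙-congˡ (lin-zero v tail≡0)) (identityʳ _)) a-rel))

  -- Modulo B both relations are multiples of z_b, so e·a′ − e′·a is a relation modulo B,
  -- hence zero; at the pivot j this forces e′ = 0, so a′ is already a relation modulo B.
  vanishing-at-pivot⇒trivial : (u : Fin k → Carrier) (a a′ : Fin k → ℤ) {j : Fin k} → Indep B u
    → InSpan (B ∪ ⁅ b ⁆) (lin M∅ a u) → a j ≢ 0ℤ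
    → InSpan (B ∪ ⁅ b ⁆) (lin M∅ a′ u) → a′ j ≡ 0ℤ → ∀ i → a′ i ≡ 0ℤ
  vanishing-at-pivot⇒trivial {k = k} {B = B} {b = b} u a a′ {j} indep a-rel a≢0 a′-rel a′≡0
    with InSpan-∪⁅⁆⁻ a-rel | InSpan-∪⁅⁆⁻ a′-rel
  ... | e , lin~e·z | e′ , lin′~e′·z = indep a′ (~ε⇒InSpan lin′~ε)
    where
    combination : Fin k → ℤ
    combination i = e ℤ.* a′ i ℤ.- e′ ℤ.* a i
    combination∈B : InSpan B (lin M∅ combination u)
    combination∈B = InSpan-resp lin-combination
      (~-trans (~-· e lin′~e′·z) (~-trans (≈⇒~ (·-comm e e′ (z b))) (~-sym (~-· e′ lin~e·z))))
      where
      lin-combination : e · lin M∅ a′ u - e′ · lin M∅ a u ≈ lin M∅ combination u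
      lin-combination = sym (trans (lin-− u (λ i → e ℤ.* a′ i) (λ i → e′ ℤ.* a i))
                                   (//-cong₂ (lin-* u e a′) (lin-* u e′ a)))
    e′*aj≡0 : e′ ℤ.* a j ≡ 0ℤ
    e′*aj≡0 = ℤ.neg-injective (begin
      ℤ.- (e′ ℤ.* a j)              ≡⟨ ℤ.+-identityˡ _ ⟨
      0ℤ ℤ.- e′ ℤ.* a j             ≡⟨ ≡.cong (ℤ._- e′ ℤ.* a j) e*a′j≡0 ⟨
      combination j                 ≡⟨ indep combination combination∈B j ⟩
      0ℤ                            ∎)
      where
      open ≡.≡-Reasoning
      e*a′j≡0 : e ℤ.* a′ j ≡ 0ℤ
      e*a′j≡0 = ≡.trans (≡.cong (e ℤ.*_) a′≡0) (ℤ.*-zeroʳ e)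
    e′≡0 : e′ ≡ 0ℤ
    e′≡0 = [ id , (λ aj≡0 → contradiction aj≡0 a≢0) ]′ (ℤ.i*j≡0⇒i≡0∨j≡0 e′ e′*aj≡0)
    lin′~ε : lin M∅ a′ u ~[ B ] ε
    lin′~ε = ~-trans lin′~e′·z (≈⇒~ (reflexive (≡.cong (_· z b) e′≡0)))

  Indep-removeAt : (u : Fin (suc k) → Carrier) (j : Fin (suc k))
    → (∀ a → InSpan B (lin M∅ a u) → a j ≡ 0ℤ → ∀ i → a i ≡ 0ℤ) → Indep B (removeAt u j)
  Indep-removeAt u j vanishing⇒trivial a a-rel i = ≡.trans (≡.sym (insertAt-punchIn a j 0ℤ i))
    (vanishing⇒trivial (insertAt a j 0ℤ) (InSpan-resp (sym (lin-insertAt a u j)) a-rel)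
                       (insertAt-lookup a j 0ℤ) (punchIn j i))

  IndepFamily-∪⁅⁆ : IndepFamily B (suc k) → ¬ ¬ IndepFamily (B ∪ ⁅ b ⁆) k
  IndepFamily-∪⁅⁆ {B = B} {k = k} {b = b} (u , indep) = ¬¬-map drop ¬¬-excluded-middle
    where
    -- Whether u has a relation modulo B ∪ {b} with a nonzero coefficient cannot be decided.
    -- If it has one, drop a vector where that coefficient is nonzero; if not, drop any.
    HasPivot : Set ℓ
    HasPivot = Σ (Fin (suc k) → ℤ) λ a → Σ (Fin (suc k)) λ j →
                 InSpan (B ∪ ⁅ b ⁆) (lin M∅ a u) × a j ≢ 0ℤ
    drop : Dec HasPivot → IndepFamily (B ∪ ⁅ b ⁆) k
    drop (yes (a , j , a-rel , a≢0)) =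
      removeAt u j , Indep-removeAt u j (λ a′ → vanishing-at-pivot⇒trivial u a a′ indep a-rel a≢0)
    drop (no ∄pivot) =
      removeAt u zero , Indep-removeAt u zero λ a a-rel _ i →
        decidable-stable (a i ℤ.≟ 0ℤ) (λ a≢0 → ∄pivot (a , i , a-rel , a≢0))

  IndepFamily-⊥⇒IndepFamily : ∀ B → Acc _⊂_ B → IndepFamily ⊥ (∣ B ∣ ℕ.+ k) → ¬ ¬ IndepFamily B k
  IndepFamily-⊥⇒IndepFamily {k = k} B (acc smaller) fam with nonempty? B
  ... | no B-empty rewrite Empty-unique B-empty | ∣⊥∣≡0 n = λ ¬fam → ¬fam fam
  ... | yes (b , b∈B) = do
      fam′ ← IndepFamily-⊥⇒IndepFamily (B ∖ b) (smaller (x∈p⇒p-x⊂p b∈B))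
                                        (≡.subst (IndepFamily ⊥) ∣B∣+k≡ fam)
      fam″ ← IndepFamily-∪⁅⁆ fam′
      pure (IndepFamily-antimono (p⊆p∖x∪⁅x⁆ b) fam″)
    where
    open RawMonad ¬¬-Monad
    ∣B∣+k≡ : ∣ B ∣ ℕ.+ k ≡ ∣ B ∖ b ∣ ℕ.+ suc k
    ∣B∣+k≡ = ≡.trans (≡.cong (ℕ._+ k) (x∈p⇒∣p∣≡1+∣p∖x∣ b∈B)) (≡.sym (ℕ.+-suc _ k))

  IsRank-∪⁅⁆⇒IsRank-suc : IndepFamily ⊥ (∣ B ∣ ℕ.+ suc k) → IsRank (B ∪ ⁅ b ⁆) k
                        → IsRank B (suc k)
  IsRank-∪⁅⁆⇒IsRank-suc {B = B} {b = b} fam∅ ((v , indep) , maximal) =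
    (z b Vector.∷ v , Indep-∷ v ¬tors indep) ,
    λ w indep-w → IndepFamily-∪⁅⁆ (w , indep-w) (uncurry maximal)
    where
    ¬tors : ¬ Tors B (z b)
    ¬tors tors = IndepFamily-⊥⇒IndepFamily B (⊂-wellFounded B) fam∅
      λ (u , indep-u) → maximal u (Indep-∪⁅⁆-Tors u tors indep-u)

  GrCond-∪⁅⁆⇒GrCond : b ∉ B → GrCond (B ∪ ⁅ b ⁆) → GrCond B
  GrCond-∪⁅⁆⇒GrCond {b = b} {B = B} b∉B (d₀ , d , rank∅ , rank , d₀≡d+∣B∪b∣) =
    d₀ , suc d , rank∅ , IsRank-∪⁅⁆⇒IsRank-suc fam∅ rank , d₀≡1+d+∣B∣
    where
    d₀≡1+d+∣B∣ : d₀ ≡ suc d ℕ.+ ∣ B ∣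
    d₀≡1+d+∣B∣ = ≡.trans d₀≡d+∣B∪b∣
                   (≡.trans (≡.cong (d ℕ.+_) (x∉p⇒∣p∪⁅x⁆∣≡1+∣p∣ b∉B)) (ℕ.+-suc d ∣ B ∣))
    fam∅ : IndepFamily ⊥ (∣ B ∣ ℕ.+ suc d)
    fam∅ = ≡.subst (IndepFamily ⊥) (≡.trans d₀≡1+d+∣B∣ (ℕ.+-comm (suc d) ∣ B ∣)) (proj₁ rank∅)

proposition3p2 : {c ℓ : Level} {n : ℕ} (M : RealizedMatroid c ℓ n)
    (A : Subset n) (b : Fin n) → b ∉ A
    → (h : Matroid.Char M (A ∪ ⁅ b ⁆)) → Matroid.GrCond M (A ∪ ⁅ b ⁆)
    → Σ (Matroid.Char M A) λ l → Matroid.GrCond M A × Matroid.Covers M A b h l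
proposition3p2 M A b b∉A h grCond =
  restrict (p⊆p∪q ⁅ b ⁆) h , GrCond-∪⁅⁆⇒GrCond b∉A grCond , restrict-covers A b h
  where open Quotients M
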